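{- Let $T$ be a finite tree and $g$ a positive integer. If the procedure Burn-Guess-Tree$(T,g)$ returns Bad-Guess, then $T$ does not admit the $g$-site condition; that is, there is no set of at most $g$ vertices of $T$ such that every vertex of $T$ is within distance $g$ of some vertex of the set.
   Context: Procedure Burn-Guess-Tree$(T,g)$: choose an arbitrary root $s$ of $T$; the level of a vertex is its distance to $s$, and the $g$-ancestor of $v$ is the vertex at distance $g$ from $v$ on the path from $v$ to $s$. Maintain a set of centers (initially empty) and a set of marked vertices (initially empty). Repeatedly: take an unmarked vertex $v$ of highest level; if its level is at least $g$, add the $g$-ancestor of $v$ to the centers, otherwise add $s$ to the centers; then mark all vertices within distance $g$ of the added center. If all vertices become marked, return the burning sequence consisting of the centers in arbitrary order. If $g$ centers have been chosen and some vertex is still unmarked (so more than $g$ centers would be needed), return Bad-Guess. A $g$-site partition is a set of at most $g$ vertices (sites) such that every vertex is within distance $g$ of its closest site; $T$ admits the $g$-site condition if it has a $g$-site partition. -}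

module Defs where

open import Data.Nat using (ℕ; zero; suc; _≤_; _<_; _∸_)
open import Data.Fin using (Fin)
open import Data.List using (List; []; _∷_; _++_; length)
open import Data.List.Membership.Propositional using (_∈_)
open import Data.List.Relation.Unary.Linked using (Linked)
open import Data.List.Relation.Unary.Unique.Propositional using (Unique)
open import Data.Product using (Σ; ∃; ∃-syntax; _×_; _,_)
open import Relation.Binary.PropositionalEquality using (_≡_; _≢_)
open import Relation.Nullary using (¬_)

record Graph (n : ℕ) : Set₁ where
  field
    Adj   : Fin n → Fin n → Set
    sym   : ∀ {u v} → Adj u v → Adj v u
    irrefl : ∀ {u} → ¬ Adj u u
open Graph public

data Walk {n : ℕ} (G : Graph n) : Fin n → Fin n → ℕ → Set where
  here : ∀ {u} → Walk G u u 0
  step : ∀ {u w v k} → Adj G u w → Walk G w v k → Walk G u v (suc k)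

Connected : ∀ {n} → Graph n → Set
Connected G = ∀ u v → ∃[ k ] Walk G u v k

HasCycle : ∀ {n} → Graph n → Set
HasCycle {n} G = ∃[ x ] ∃[ ys ] (2 ≤ length ys × Unique (x ∷ ys) × Linked (Adj G) (x ∷ ys ++ x ∷ []))

record IsTree {n : ℕ} (G : Graph n) : Set where
  field
    connected : Connected G
    acyclic   : ¬ HasCycle G

Within : ∀ {n} → Graph n → Fin n → Fin n → ℕ → Set
Within G u v d = ∃[ k ] (k ≤ d × Walk G u v k)

Dist : ∀ {n} → Graph n → Fin n → Fin n → ℕ → Set
Dist G u v d = Walk G u v d × (∀ k → Walk G u v k → d ≤ k)

SiteCondition : ∀ {n} → Graph n → ℕ → Set
SiteCondition {n} G g =
  ∃[ S ] (length S ≤ g × (∀ (x : Fin n) → ∃[ y ] (y ∈ S × Within G x y g)))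

-- Burn-Guess-Tree(T, g) with root s, modelled nondeterministically
-- (the choice of the unmarked vertex of highest level is arbitrary).

module BurnGuess {n : ℕ} (G : Graph n) (s : Fin n) (g : ℕ) where

  Level : Fin n → ℕ → Set
  Level v l = Dist G v s l

  Ancestor : Fin n → Fin n → Set
  Ancestor v a = ∃[ l ] (Level v l × Walk G v a g × Walk G a s (l ∸ g))

  Marked : List (Fin n) → Fin n → Set
  Marked C x = ∃[ c ] (c ∈ C × Within G x c g)

  data NextCenter (C : List (Fin n)) : Fin n → Set where
    choose : ∀ v l c →
      ¬ Marked C v →
      Level v l →
      (∀ u l′ → ¬ Marked C u → Level u l′ → l′ ≤ l) →
      (g ≤ l → Ancestor v c) →
      (l < g → c ≡ s) →
      NextCenter C c

  -- Reachable C : some run of the procedure arrives at center list C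
  -- (most recent center first) without having returned.
  data Reachable : List (Fin n) → Set where
    start : Reachable []
    next  : ∀ {C c} → Reachable C → length C < g → NextCenter C c → Reachable (c ∷ C)

  ReturnsBadGuess : Set
  ReturnsBadGuess = ∃[ C ] (Reachable C × length C ≡ g × ∃[ x ] ¬ Marked C x)

-- Let v₁, …, v_g be the unmarked vertices of highest level picked by the run and x a
-- vertex still unmarked at the end. No vertex is within distance g of two of
-- v₁, …, v_g, x: if y were within g of vᵢ and of a later vertex u (of level at most that
-- of vᵢ), then the tree path from u to vᵢ through y climbs to a common ancestor m of
-- height at most g above u, and whether m lies above or below the g-ancestor cᵢ of vᵢ,
-- u is within g of cᵢ — so u would have been marked. Hence g + 1 vertices need pairwise
-- distinct sites, which rules out a g-site partition.
module Submission where

open import Defs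
open import Data.Nat using (ℕ; zero; suc; _+_; _∸_; _≤_; _<_; z≤n; s≤s; _≤?_)
open import Data.Nat.Properties
open import Data.Nat.Induction using (<-wellFounded)
open import Induction.WellFounded using (Acc; acc)
open import Data.Fin using (Fin) renaming (zero to fzero; suc to fsuc)
open import Data.Fin.Properties using () renaming (_≟_ to _≟ᶠ_)
open import Data.List using (List; []; _∷_; _∷ʳ_; length)
open import Data.List.Properties using (length-removeAt′; length-++-≤ʳ)
open import Data.List.Membership.Propositional using (_∈_)
open import Data.List.Relation.Unary.Any using (here; there; _─_)
open import Data.List.Relation.Unary.All as All using (All; []; _∷_)
import Data.List.Relation.Unary.All.Properties as All
open import Data.List.Relation.Unary.AllPairs using (AllPairs; []; _∷_)
import Data.List.Relation.Unary.AllPairs.Properties as AllPairs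
open import Data.List.Relation.Unary.Linked using (Linked; []; [-]; _∷_)
open import Data.List.Relation.Unary.Unique.Propositional using (Unique)
open import Data.Product using (∃; ∃-syntax; _×_; _,_; proj₁; proj₂)
open import Data.Sum using (_⊎_; inj₁; inj₂)
open import Data.Empty using (⊥; ⊥-elim)
open import Function using (_∘_)
open import Relation.Nullary using (¬_; Dec; yes; no)
open import Relation.Binary.Definitions using (DecidableEquality; tri<; tri≈; tri>)
open import Relation.Binary.PropositionalEquality as ≡
  using (_≡_; _≢_; refl; cong; subst; subst₂; ≢-sym)

¬¬-Π-Fin : ∀ {m} {P : Fin m → Set} → (∀ i → ¬ ¬ P i) → ¬ ¬ (∀ i → P i)
¬¬-Π-Fin {zero}      _ k = k λ ()
¬¬-Π-Fin {suc m} {P} h k =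
  h fzero λ p₀ → ¬¬-Π-Fin {P = P ∘ fsuc} (h ∘ fsuc) λ ps → k λ { fzero → p₀ ; (fsuc i) → ps i }

Linked-∷ʳ⁺ : ∀ {A : Set} {R : A → A → Set} xs {x y} →
             Linked R (xs ∷ʳ x) → R x y → Linked R (xs ∷ʳ x ∷ʳ y)
Linked-∷ʳ⁺ []            _         Rxy = Rxy ∷ [-]
Linked-∷ʳ⁺ (_ ∷ [])      (Rx ∷ l)  Rxy = Rx ∷ Linked-∷ʳ⁺ [] l Rxy
Linked-∷ʳ⁺ (_ ∷ x′ ∷ xs) (Rx ∷ l)  Rxy = Rx ∷ Linked-∷ʳ⁺ (x′ ∷ xs) l Rxy

AllPairs-∷ʳ⁺ : ∀ {A : Set} {R : A → A → Set} {xs y} →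
               AllPairs R xs → All (λ x → R x y) xs → AllPairs R (xs ∷ʳ y)
AllPairs-∷ʳ⁺ Rxs Rxsy = AllPairs.++⁺ Rxs ([] ∷ []) (All.map (_∷ []) Rxsy)

∈-─ : ∀ {B : Set} {bs : List B} {b b′} (p : b ∈ bs) → b′ ∈ bs → b′ ≢ b → b′ ∈ (bs ─ p)
∈-─ (here refl) (here refl) b′≢b = ⊥-elim (b′≢b refl)
∈-─ (here refl) (there q)   _    = q
∈-─ (there p)   (here refl) _    = here refl
∈-─ (there p)   (there q)   b′≢b = there (∈-─ p q b′≢b)

module _ {A B : Set} (_≟_ : DecidableEquality B) {R : A → A → Set} {Q : A → B → Set}
         (exclusive : ∀ {a a′ b} → R a a′ → Q a b → Q a′ b → ⊥) where

  pigeonhole : ∀ {as bs} → AllPairs R as → All (λ a → ∃[ b ] (b ∈ bs × Q a b)) as →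
               length as ≤ length bs
  pigeonhole []                  []                              = z≤n
  pigeonhole {a ∷ _} {bs} (Ra ∷ Ras) ((b , b∈bs , Qab) ∷ Qas) =
    subst (_ ≤_) (≡.sym (length-removeAt′ bs _)) (s≤s (pigeonhole Ras (All.zipWith avoid-b (Ra , Qas))))
    where
      avoid-b : ∀ {a′} → R a a′ × ∃[ b′ ] (b′ ∈ bs × Q a′ b′) → ∃[ b′ ] (b′ ∈ (bs ─ b∈bs) × Q a′ b′)
      avoid-b (Raa′ , b′ , b′∈bs , Qa′b′) with b′ ≟ b
      ... | yes refl = ⊥-elim (exclusive Raa′ Qab Qa′b′)
      ... | no  b′≢b = b′ , ∈-─ b∈bs b′∈bs b′≢b , Qa′b′

module Walks {n} (G : Graph n) where

  infixr 5 _++ᵂ_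

  _++ᵂ_ : ∀ {u v w j k} → Walk G u v j → Walk G v w k → Walk G u w (j + k)
  here       ++ᵂ q = q
  step a p   ++ᵂ q = step a (p ++ᵂ q)

  _∷ʳᵂ_ : ∀ {u v w k} → Walk G u v k → Adj G v w → Walk G u w (suc k)
  here     ∷ʳᵂ a = step a here
  step b p ∷ʳᵂ a = step b (p ∷ʳᵂ a)

  reverseᵂ : ∀ {u v k} → Walk G u v k → Walk G v u k
  reverseᵂ here       = here
  reverseᵂ (step a p) = reverseᵂ p ∷ʳᵂ sym G a

  -- Adjacency is not decidable, so a shortest walk exists only up to double negation;
  -- this suffices because the theorem concludes ⊥.
  ¬¬-dist : ∀ {u v k} → Walk G u v k → ¬ ¬ ∃ (Dist G u v)
  ¬¬-dist = go _ (<-wellFounded _)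
    where
      go : ∀ {u v} k → Acc _<_ k → Walk G u v k → ¬ ¬ ∃ (Dist G u v)
      go {u} {v} k (acc shorter) w no-dist = no-dist (k , w , shortest)
        where
          shortest : ∀ k′ → Walk G u v k′ → k ≤ k′
          shortest k′ w′ with k ≤? k′
          ... | yes k≤k′ = k≤k′
          ... | no  k≰k′ = ⊥-elim (go k′ (shorter (≰⇒> k≰k′)) w′ no-dist)

module LevelledTree {n} (G : Graph n) (acyclic : ¬ HasCycle G) (s : Fin n)
                    (lev : Fin n → ℕ) (lev-dist : ∀ v → Dist G v s (lev v)) where
  open Walks G

  root-walk : ∀ v → Walk G v s (lev v)
  root-walk v = proj₁ (lev-dist v)

  lev-≤ : ∀ {v k} → Walk G v s k → lev v ≤ k
  lev-≤ {v} = proj₂ (lev-dist v) _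

  lev-≤-walk : ∀ {v c k} → Walk G v c k → lev v ≤ k + lev c
  lev-≤-walk {c = c} w = lev-≤ (w ++ᵂ root-walk c)

  lev-unique : ∀ {v d} → Dist G v s d → d ≡ lev v
  lev-unique {v} (w , shortest) = ≤-antisym (shortest _ (root-walk v)) (lev-≤ w)

  lev≡0⇒root : ∀ {v} → lev v ≡ 0 → v ≡ s
  lev≡0⇒root {v} lev≡0 with subst (Walk G v s) lev≡0 (root-walk v)
  ... | here = refl

  lev<⇒≢ : ∀ {u v} → lev u < lev v → u ≢ v
  lev<⇒≢ lt refl = <-irrefl refl lt

  Parent : Fin n → Fin n → Set
  Parent v p = Adj G v p × suc (lev p) ≡ lev v

  parent : ∀ {v L} → lev v ≡ suc L → ∃ (Parent v)
  parent {v} {L} lev≡ with subst (Walk G v s) lev≡ (root-walk v)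
  ... | step {w = p} v~p p⇝s =
    p , v~p , ≤-antisym (subst (suc (lev p) ≤_) (≡.sym lev≡) (s≤s (lev-≤ p⇝s))) (lev-≤-walk (step v~p here))

  -- Climbing from p and q to their parents closes the path into a cycle or lifts it one level up.
  ¬path-below-level : ∀ L {p q} M → lev p ≡ L → lev q ≡ L → All (λ x → L < lev x) M →
                      Unique (p ∷ M ∷ʳ q) → Linked (Adj G) (p ∷ M ∷ʳ q) → ⊥
  ¬path-below-level zero    M p-lev q-lev _ (p∉ ∷ _) _ =
    proj₂ (All.∷ʳ⁻ p∉) (≡.trans (lev≡0⇒root p-lev) (≡.sym (lev≡0⇒root q-lev)))
  ¬path-below-level (suc L) {p} {q} M p-lev q-lev M-below unique linked
    with parent p-lev | parent q-lev
  ... | p′ , p~p′ , p′-lev | q′ , q~q′ , q′-lev = close-or-lift (p′ ≟ᶠ q′)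
    where
      p′-lev′ : lev p′ ≡ L
      p′-lev′ = suc-injective (≡.trans p′-lev p-lev)
      q′-lev′ : lev q′ ≡ L
      q′-lev′ = suc-injective (≡.trans q′-lev q-lev)
      path-below : All (λ x → L < lev x) (p ∷ M ∷ʳ q)
      path-below = subst (L <_) (≡.sym p-lev) ≤-refl
                 ∷ All.∷ʳ⁺ (All.map (<-trans (n<1+n L)) M-below) (subst (L <_) (≡.sym q-lev) ≤-refl)
      p′∉ : All (p′ ≢_) (p ∷ M ∷ʳ q)
      p′∉ = All.map (lev<⇒≢ ∘ subst (_< _) (≡.sym p′-lev′)) path-below
      q′∉ : All (_≢ q′) (p ∷ M ∷ʳ q)
      q′∉ = All.map (≢-sym ∘ lev<⇒≢ ∘ subst (_< _) (≡.sym q′-lev′)) path-below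
      lifted : Linked (Adj G) (p′ ∷ (p ∷ M ∷ʳ q) ∷ʳ q′)
      lifted = sym G p~p′ ∷ Linked-∷ʳ⁺ (p ∷ M) linked q~q′
      two-vertices : 2 ≤ length (p ∷ M ∷ʳ q)
      two-vertices = s≤s (length-++-≤ʳ (q ∷ []) {M})
      close-or-lift : Dec (p′ ≡ q′) → ⊥
      close-or-lift (yes refl) = acyclic (p′ , p ∷ M ∷ʳ q , two-vertices , p′∉ ∷ unique , lifted)
      close-or-lift (no p′≢q′) = ¬path-below-level L (p ∷ M ∷ʳ q) p′-lev′ q′-lev′ path-below
                                   (All.∷ʳ⁺ p′∉ p′≢q′ ∷ AllPairs-∷ʳ⁺ unique q′∉) lifted

  adj⇒lev-suc : ∀ {u w} → Adj G u w → lev w ≡ suc (lev u) ⊎ lev u ≡ suc (lev w)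
  adj⇒lev-suc {u} {w} u~w with <-cmp (lev u) (lev w)
  ... | tri< u<w _ _ = inj₁ (≤-antisym (lev-≤-walk (step (sym G u~w) here)) u<w)
  ... | tri> _ _ w<u = inj₂ (≤-antisym (lev-≤-walk (step u~w here)) w<u)
  ... | tri≈ _ u≡w _ = ⊥-elim (¬path-below-level (lev u) [] refl (≡.sym u≡w) []
                                 ((u≢w ∷ []) ∷ [] ∷ []) (u~w ∷ [-]))
    where
      u≢w : u ≢ w
      u≢w refl = irrefl G u~w

  parent-unique : ∀ {v p q} → Parent v p → Parent v q → p ≡ q
  parent-unique {v} {p} {q} (v~p , p-lev) (v~q , q-lev) with p ≟ᶠ q
  ... | yes p≡q = p≡q
  ... | no  p≢q = ⊥-elim (¬path-below-level (lev p) (v ∷ []) refl q-lev′ (p<v ∷ [])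
                            ((lev<⇒≢ p<v ∷ p≢q ∷ []) ∷ (≢-sym (lev<⇒≢ q<v) ∷ []) ∷ [] ∷ [])
                            (sym G v~p ∷ v~q ∷ [-]))
    where
      q-lev′ : lev q ≡ lev p
      q-lev′ = suc-injective (≡.trans q-lev (≡.sym p-lev))
      p<v : lev p < lev v
      p<v = subst (suc (lev p) ≤_) p-lev ≤-refl
      q<v : lev q < lev v
      q<v = subst (suc (lev q) ≤_) q-lev ≤-refl

  data Ascent : ℕ → Fin n → Fin n → Set where
    []  : ∀ {v} → Ascent 0 v v
    _∷_ : ∀ {j v p a} → Parent v p → Ascent j p a → Ascent (suc j) v a

  ascent-lev : ∀ {j v a} → Ascent j v a → lev v ≡ j + lev a
  ascent-lev []                 = refl
  ascent-lev ((_ , p-lev) ∷ up) = ≡.trans (≡.sym p-lev) (cong suc (ascent-lev up))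

  ascent-walk : ∀ {j v a} → Ascent j v a → Walk G v a j
  ascent-walk []             = here
  ascent-walk ((v~p , _) ∷ up) = step v~p (ascent-walk up)

  _∷ʳᴬ_ : ∀ {j v a b} → Ascent j v a → Parent a b → Ascent (suc j) v b
  []        ∷ʳᴬ a↑b = a↑b ∷ []
  (v↑ ∷ up) ∷ʳᴬ a↑b = v↑ ∷ (up ∷ʳᴬ a↑b)

  ascents-comparable : ∀ {i j v a b} → Ascent i v a → Ascent j v b →
                       (∃[ d ] (i + d ≡ j × Ascent d a b)) ⊎ (∃[ d ] (j + d ≡ i × Ascent d b a))
  ascents-comparable []         v↑b        = inj₁ (_ , refl , v↑b)
  ascents-comparable v↑a        []         = inj₂ (_ , refl , v↑a)
  ascents-comparable (p ∷ v↑a) (p′ ∷ v↑b) with parent-unique p p′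
  ... | refl with ascents-comparable v↑a v↑b
  ...   | inj₁ (d , i+d≡j , a↑b) = inj₁ (d , cong suc i+d≡j , a↑b)
  ...   | inj₂ (d , j+d≡i , b↑a) = inj₂ (d , cong suc j+d≡i , b↑a)

  walk⇒ascent : ∀ {v c k} → Walk G v c k → lev v ≡ k + lev c → Ascent k v c
  walk⇒ascent here                     _     = []
  walk⇒ascent {c = c} (step {k = k} v~w w⇝c) v-lev with adj⇒lev-suc v~w
  ... | inj₂ w-lev = (v~w , ≡.sym w-lev) ∷ walk⇒ascent w⇝c (suc-injective (≡.trans (≡.sym w-lev) v-lev))
  ... | inj₁ w-lev = ⊥-elim (1+n≰n (≤-trans (n≤1+n _) too-deep))
    where
      too-deep : suc (suc (k + lev c)) ≤ k + lev c
      too-deep = subst (_≤ k + lev c) (≡.trans w-lev (cong suc v-lev)) (lev-≤-walk w⇝c)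

  walk⇒common-ancestor : ∀ {u v k} → Walk G u v k →
                         ∃[ i ] ∃[ j ] ∃[ m ] (Ascent i u m × Ascent j v m × i + j ≤ k)
  walk⇒common-ancestor here = 0 , 0 , _ , [] , [] , z≤n
  walk⇒common-ancestor (step u~w w⇝v) with walk⇒common-ancestor w⇝v | adj⇒lev-suc u~w
  ... | i , j , m , w↑m , v↑m , i+j≤k | inj₂ w-lev =
    suc i , j , m , (u~w , ≡.sym w-lev) ∷ w↑m , v↑m , s≤s i+j≤k
  ... | _ , j , _ , [] , v↑m , j≤k | inj₁ w-lev =
    0 , suc j , _ , [] , v↑m ∷ʳᴬ (sym G u~w , ≡.sym w-lev) , s≤s j≤k
  ... | _ , j , m , w↑p ∷ p↑m , v↑m , i+j≤k | inj₁ w-lev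
    with parent-unique w↑p (sym G u~w , ≡.sym w-lev)
  ...   | refl = _ , j , m , p↑m , v↑m , m≤n⇒m≤1+n (<⇒≤ i+j≤k)

  -- The common ancestor m of u and v lies either below or above the g-ancestor c of v;
  -- in both cases the walk u ↑ m ⇝ c has length at most g.
  ancestor-ball : ∀ {g u v c y} → Ascent g v c → lev u ≤ lev v →
                  Within G u y g → Within G v y g → Within G u c g
  ancestor-ball {g} {u} {v} v↑c u≤v (k₁ , k₁≤g , u⇝y) (k₂ , k₂≤g , v⇝y)
    with walk⇒common-ancestor (u⇝y ++ᵂ reverseᵂ v⇝y)
  ... | i , j , m , u↑m , v↑m , i+j≤k with ascents-comparable v↑m v↑c
  ... | inj₁ (d , j+d≡g , m↑c) =
    i + d , ≤-trans (+-monoˡ-≤ d i≤j) (≤-reflexive j+d≡g) , ascent-walk u↑m ++ᵂ ascent-walk m↑c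
    where
      i≤j : i ≤ j
      i≤j = +-cancelʳ-≤ (lev m) i j (subst₂ _≤_ (ascent-lev u↑m) (ascent-lev v↑m) u≤v)
  ... | inj₂ (d , g+d≡j , c↑m) =
    i + d , +-cancelʳ-≤ g (i + d) g i+d+g≤g+g , ascent-walk u↑m ++ᵂ reverseᵂ (ascent-walk c↑m)
    where
      open ≤-Reasoning
      i+d+g≤g+g : i + d + g ≤ g + g
      i+d+g≤g+g = begin
        i + d + g   ≡⟨ +-assoc i d g ⟩
        i + (d + g) ≡⟨ cong (i +_) (≡.trans (+-comm d g) g+d≡j) ⟩
        i + j       ≤⟨ i+j≤k ⟩
        k₁ + k₂     ≤⟨ +-mono-≤ k₁≤g k₂≤g ⟩
        g + g       ∎

  module Burning (g : ℕ) where
    open BurnGuess G s g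

    Separated : Fin n → Fin n → Set
    Separated a b = ∀ y → Within G a y g → Within G b y g → ⊥

    ancestor⇒ascent : ∀ {v c} → g ≤ lev v → Ancestor v c → Ascent g v c
    ancestor⇒ascent {v} {c} g≤v (l , v-lev , v⇝c , c⇝s) =
      walk⇒ascent v⇝c (≤-antisym (lev-≤-walk v⇝c) c-high)
      where
        open ≤-Reasoning
        c-high : g + lev c ≤ lev v
        c-high = begin
          g + lev c       ≤⟨ +-monoʳ-≤ g (lev-≤ c⇝s) ⟩
          g + (l ∸ g)     ≡⟨ cong (λ l′ → g + (l′ ∸ g)) (lev-unique v-lev) ⟩
          g + (lev v ∸ g) ≡⟨ m+[n∸m]≡n g≤v ⟩
          lev v           ∎

    next-center-separates : ∀ {v l c u} → Level v l → (g ≤ l → Ancestor v c) → (l < g → c ≡ s) →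
                            lev u ≤ l → ¬ Within G u c g → Separated u v
    next-center-separates {v} {l} {c} {u} v-lev ancestor at-root u≤l u-far y u~y v~y with g ≤? l
    ... | yes g≤l = u-far (ancestor-ball (ancestor⇒ascent g≤v (ancestor g≤l)) u≤v u~y v~y)
      where
        g≤v : g ≤ lev v
        g≤v = subst (g ≤_) (lev-unique v-lev) g≤l
        u≤v : lev u ≤ lev v
        u≤v = subst (lev u ≤_) (lev-unique v-lev) u≤l
    ... | no g≰l = u-far (lev u , ≤-trans u≤l (<⇒≤ (≰⇒> g≰l)) , u⇝c)
      where
        u⇝c : Walk G u c (lev u)
        u⇝c = subst (λ t → Walk G u t (lev u)) (≡.sym (at-root (≰⇒> g≰l))) (root-walk u)

    record Certificate (C : List (Fin n)) : Set where
      field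
        chosen             : List (Fin n)
        length-chosen      : length chosen ≡ length C
        chosen-separated   : AllPairs Separated chosen
        unmarked-separated : ∀ u → ¬ Marked C u → All (Separated u) chosen

    certificate : ∀ {C} → Reachable C → Certificate C
    certificate start = record
      { chosen             = []
      ; length-chosen      = refl
      ; chosen-separated   = []
      ; unmarked-separated = λ _ _ → []
      }
    certificate {c ∷ C} (next run _ (choose v l _ v-unmarked v-lev highest ancestor at-root)) = record
      { chosen             = v ∷ chosen
      ; length-chosen      = cong suc length-chosen
      ; chosen-separated   = unmarked-separated v v-unmarked ∷ chosen-separated
      ; unmarked-separated = λ u u-unmarked →
          next-center-separates v-lev ancestor at-root
            (highest u (lev u) (still-unmarked u-unmarked) (lev-dist u)) (u-unmarked ∘ marked-by-c)
          ∷ unmarked-separated u (still-unmarked u-unmarked)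
      }
      where
        open Certificate (certificate run)
        still-unmarked : ∀ {u} → ¬ Marked (c ∷ C) u → ¬ Marked C u
        still-unmarked u-unmarked (c′ , c′∈C , u~c′) = u-unmarked (c′ , there c′∈C , u~c′)
        marked-by-c : ∀ {u} → Within G u c g → Marked (c ∷ C) u
        marked-by-c u~c = c , here refl , u~c

lemma5 : ∀ {n} (T : Graph n) → IsTree T → (g : ℕ) → 1 ≤ g → (s : Fin n) →
    BurnGuess.ReturnsBadGuess T s g → ¬ SiteCondition T g
lemma5 T tree g _ s (C , run , |C|≡g , x , x-unmarked) (S , |S|≤g , covered) =
  ¬¬-Π-Fin (λ v → ¬¬-dist (proj₂ (connected v s))) too-many-sites
  where
    open IsTree tree
    open Walks T

    too-many-sites : (∀ v → ∃ (Dist T v s)) → ⊥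
    too-many-sites dist = 1+n≰n (≤-trans (subst (_≤ length S) |x∷chosen|≡1+g sites) |S|≤g)
      where
        open LevelledTree T acyclic s (proj₁ ∘ dist) (proj₂ ∘ dist)
        open Burning g
        open Certificate (certificate run)
        |x∷chosen|≡1+g : length (x ∷ chosen) ≡ suc g
        |x∷chosen|≡1+g = cong suc (≡.trans length-chosen |C|≡g)
        sites : length (x ∷ chosen) ≤ length S
        sites = pigeonhole _≟ᶠ_ (λ separated → separated _)
                  (unmarked-separated x x-unmarked ∷ chosen-separated) (All.tabulate λ {z} _ → covered z)
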